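{- Let $l$ be a complete lattice which is a de Morgan algebra with residual implication. Let $TS=(S,Act,\to,I,AP,L)$ be an mv-transition system without terminal states, let $P:(2^{AP})^{\omega}\to l$ be a safety property, and let $\mathcal A=(Q,2^{AP},\delta,q_0,F)$ be an $l$-valued deterministic finite automaton with $L(\mathcal A)=\mathrm{GPref}(P)$. Then the following are equivalent: (1) $TS\models P$; (2) $\mathrm{Traces}_{fin}(TS)\subseteq L(\mathcal A)$; (3) $TS\otimes\mathcal A\models \mathrm{inv}(\varphi)$, where $\varphi=\bigvee_{q\in Q}(F(q)\wedge q)$ is an mv-proposition formula over the atomic propositions $Q$.
   Context: $l$: complete distributive lattice with $x\wedge\bigvee a_i=\bigvee(x\wedge a_i)$, order-reversing involution $\neg$, implication $a\to b=\bigvee\{c:a\wedge c\le b\}$. An mv-TS is $(S,Act,\to,I,AP,L)$ with finite $S,Act,AP$, transition map $\eta:S\times Act\times S\to l$, $I:S\to l$, $L:S\to2^{AP}$; it has no terminal states if for each $s$ there are $\alpha,s'$ with $\eta(s,\alpha,s')>0$. For an execution $\rho=s_0\alpha_1s_1\cdots$, $v(\rho)=I(s_0)\wedge\bigwedge_i\eta(s_i,\alpha_{i+1},s_{i+1})$; $\mathrm{Traces}(TS)(\sigma)=\bigvee\{v(\rho):L(s_0)L(s_1)\cdots=\sigma\}$; $\mathrm{Traces}_{fin}(TS)(\theta)=\bigvee_{\tau}\mathrm{Traces}(TS)(\theta\tau)$; $TS\models P$ iff $\mathrm{Traces}(TS)\le P$ pointwise. $\mathrm{GPref}(P)(\theta)=\bigvee_\tau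 P(\theta\tau)$; $P$ is safety if $\bigwedge_{\theta\in\mathrm{Pref}(\sigma)}\mathrm{GPref}(P)(\theta)\le P(\sigma)$ for all $\sigma$ ($\mathrm{Pref}(\sigma)$ = finite prefixes). An $l$-VDFA $(Q,\Sigma,\delta,q_0,F)$ has finite $Q$, $\delta:Q\times\Sigma\to Q$, $q_0\in Q$, $F:Q\to l$; $L(\mathcal A)(\sigma_1\cdots\sigma_k)=F(q_k)$ where $q_{i+1}=\delta(q_i,\sigma_{i+1})$. The product $TS\otimes\mathcal A=(S\times Q,Act,\to',I',Q,L')$ has $\eta'((s,q),\alpha,(t,p))=\eta(s,\alpha,t)$ if $\delta(q,L(t))=p$ and $0$ otherwise; $I'(s,q)=I(s)$ if $\delta(q_0,L(s))=q$ and $0$ otherwise; $L'(s,q)=\{q\}$. mv-proposition formulas over a set $AP'$: $\psi::=A\mid r\mid\psi\vee\psi\mid\psi\to\psi\mid\neg\psi$ ($A\in AP'$, $r\in l$, $\psi_1\wedge\psi_2:=\neg(\neg\psi_1\vee\neg\psi_2)$); $\psi(\Phi)$ for $\Phi\subseteq AP'$ evaluates $A\mapsto1$ if $A\in\Phi$ else $0$. $\mathrm{inv}(\psi)(A_0A_1\cdots)=\bigwedge_i\psi(A_i)$. -}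

module Defs where

open import Data.Nat using (ℕ; zero; suc)
open import Data.Bool using (Bool; true; false; if_then_else_)
open import Data.Empty using (⊥)
open import Data.Fin using (Fin; _≟_)
open import Data.Fin.Subset using (Subset; ⁅_⁆; _∈_)
open import Data.Fin.Subset.Properties using (_∈?_)
open import Data.List using (List; []; _∷_; foldl; foldr; applyUpTo; allFin)
open import Data.Product using (Σ; _×_; _,_; proj₁; proj₂)
open import Relation.Binary.PropositionalEquality using (_≡_)
open import Relation.Binary.Structures using (IsPartialOrder)
open import Relation.Nullary using (¬_)
open import Relation.Nullary.Decidable using (⌊_⌋)

infixr 5 _++ω_
_++ω_ : {A : Set} → List A → (ℕ → A) → ℕ → A
([] ++ω τ) i = τ i
((x ∷ θ) ++ω τ) zero = x
((x ∷ θ) ++ω τ) (suc i) = (θ ++ω τ) i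

-- Complete distributive lattice (with x ∧ ⋁ aᵢ = ⋁ (x ∧ aᵢ)) carrying an
-- order-reversing involution ~ (a de Morgan algebra); the residual
-- implication is defined below as ⋁ {c : a ∧ c ≤ b}.

record CDMLattice : Set₁ where
  infix 4 _≈_ _≤_
  field
    Carrier        : Set
    _≈_            : Carrier → Carrier → Set
    _≤_            : Carrier → Carrier → Set
    isPartialOrder : IsPartialOrder _≈_ _≤_
    ⋁              : {I : Set} → (I → Carrier) → Carrier
    ⋁-upper        : {I : Set} (a : I → Carrier) (i : I) → a i ≤ ⋁ a
    ⋁-least        : {I : Set} (a : I → Carrier) (x : Carrier) →
                     ((i : I) → a i ≤ x) → ⋁ a ≤ x
    ⋀              : {I : Set} → (I → Carrier) → Carrier
    ⋀-lower        : {I : Set} (a : I → Carrier) (i : I) → ⋀ a ≤ a i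
    ⋀-greatest     : {I : Set} (a : I → Carrier) (x : Carrier) →
                     ((i : I) → x ≤ a i) → x ≤ ⋀ a
    -- infinite distributivity x ∧ ⋁ aᵢ = ⋁ (x ∧ aᵢ) (binary ∧ = ⋀ over Bool)
    distrib        : {I : Set} (x : Carrier) (a : I → Carrier) →
                     ⋀ (λ b → if b then x else ⋁ a)
                       ≈ ⋁ (λ i → ⋀ (λ b → if b then x else a i))
    ~_             : Carrier → Carrier
    ~-involutive   : (x : Carrier) → ~ (~ x) ≈ x
    ~-antitone     : {x y : Carrier} → x ≤ y → ~ y ≤ ~ x

  infixr 7 _∧_
  infixr 6 _∨_
  _∧_ : Carrier → Carrier → Carrier
  x ∧ y = ⋀ (λ b → if b then x else y)

  _∨_ : Carrier → Carrier → Carrier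
  x ∨ y = ⋁ (λ b → if b then x else y)

  0l : Carrier
  0l = ⋁ {⊥} (λ ())

  1l : Carrier
  1l = ⋀ {⊥} (λ ())

  _⇒_ : Carrier → Carrier → Carrier
  a ⇒ b = ⋁ {Σ Carrier (λ c → a ∧ c ≤ b)} proj₁

module _ (𝕃 : CDMLattice) where
  open CDMLattice 𝕃

  Word : ℕ → Set
  Word n = ℕ → Subset n

  FinWord : ℕ → Set
  FinWord n = List (Subset n)

  -- mv-transition systems; AP = Fin n, 2^AP = Subset n

  record MvTS (S Act : Set) (n : ℕ) : Set where
    field
      η : S → Act → S → Carrier
      I : S → Carrier
      L : S → Subset n

  -- an execution s₀ α₁ s₁ α₂ s₂ ⋯ (act i plays the role of α_{i+1})
  record Exec (S Act : Set) : Set where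
    field
      st  : ℕ → S
      act : ℕ → Act

  module _ {S Act : Set} {n : ℕ} (TS : MvTS S Act n) where
    open MvTS TS
    open Exec

    NoTerminal : Set
    NoTerminal = (s : S) → Σ Act (λ α → Σ S (λ s' → ¬ (η s α s' ≈ 0l)))

    value : Exec S Act → Carrier
    value ρ = I (st ρ 0) ∧ ⋀ (λ i → η (st ρ i) (act ρ i) (st ρ (suc i)))

    Traces : Word n → Carrier
    Traces σ = ⋁ {Σ (Exec S Act) (λ ρ → (i : ℕ) → L (st ρ i) ≡ σ i)}
                 (λ p → value (proj₁ p))

    Traces-fin : FinWord n → Carrier
    Traces-fin θ = ⋁ (λ (τ : Word n) → Traces (θ ++ω τ))

    _⊨_ : (Word n → Carrier) → Set
    _⊨_ P = (σ : Word n) → Traces σ ≤ P σ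

  GPref : {n : ℕ} → (Word n → Carrier) → FinWord n → Carrier
  GPref P θ = ⋁ (λ (τ : Word _) → P (θ ++ω τ))

  prefix : {n : ℕ} → Word n → ℕ → FinWord n
  prefix σ k = applyUpTo σ k

  IsSafety : {n : ℕ} → (Word n → Carrier) → Set
  IsSafety {n} P = (σ : Word n) → ⋀ (λ k → GPref P (prefix σ k)) ≤ P σ

  Extensional : {n : ℕ} → (Word n → Carrier) → Set
  Extensional {n} P = (σ σ' : Word n) → ((i : ℕ) → σ i ≡ σ' i) → P σ ≈ P σ'

  record VDFA (nQ n : ℕ) : Set where
    field
      δ  : Fin nQ → Subset n → Fin nQ
      q₀ : Fin nQ
      F  : Fin nQ → Carrier

  Lang : {nQ n : ℕ} → VDFA nQ n → FinWord n → Carrier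
  Lang 𝒜 θ = F (foldl δ q₀ θ)
    where open VDFA 𝒜

  _⊗_ : {S Act : Set} {n nQ : ℕ} → MvTS S Act n → VDFA nQ n →
        MvTS (S × Fin nQ) Act nQ
  TS ⊗ 𝒜 = record
    { η = λ { (s , q) α (t , p) →
                if ⌊ δ q (L t) ≟ p ⌋ then η s α t else 0l }
    ; I = λ { (s , q) → if ⌊ δ q₀ (L s) ≟ q ⌋ then I s else 0l }
    ; L = λ { (s , q) → ⁅ q ⁆ }
    }
    where open MvTS TS
          open VDFA 𝒜

  data Formula (m : ℕ) : Set where
    atom  : Fin m → Formula m
    const : Carrier → Formula m
    _∨f_  : Formula m → Formula m → Formula m
    _⇒f_  : Formula m → Formula m → Formula m
    ~f_   : Formula m → Formula m

  _∧f_ : {m : ℕ} → Formula m → Formula m → Formula m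
  ψ₁ ∧f ψ₂ = ~f ((~f ψ₁) ∨f (~f ψ₂))

  eval : {m : ℕ} → Formula m → Subset m → Carrier
  eval (atom A) Φ = if ⌊ A ∈? Φ ⌋ then 1l else 0l
  eval (const r) Φ = r
  eval (ψ₁ ∨f ψ₂) Φ = eval ψ₁ Φ ∨ eval ψ₂ Φ
  eval (ψ₁ ⇒f ψ₂) Φ = eval ψ₁ Φ ⇒ eval ψ₂ Φ
  eval (~f ψ) Φ = ~ eval ψ Φ

  inv : {m : ℕ} → Formula m → Word m → Carrier
  inv ψ w = ⋀ (λ i → eval ψ (w i))

  -- φ = ⋁_{q ∈ Q} (F(q) ∧ q)   (empty disjunction = constant 0)
  φ : {nQ n : ℕ} → VDFA nQ n → Formula nQ
  φ {nQ} 𝒜 = foldr (λ q ψ → (const (F q) ∧f atom q) ∨f ψ) (const 0l) (allFin nQ)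
    where open VDFA 𝒜

-- All three conditions amount to: every execution of TS has value at most F(qᵢ) for
-- every state qᵢ of the run of 𝒜 on its trace σ.  Since F(qᵢ) = L(𝒜)(σ₀⋯σᵢ) =
-- GPref(P)(σ₀⋯σᵢ), safety turns this into (1), and it is (2) because Traces_fin(θ) is
-- the join of the values of executions whose trace extends θ.  For (3), an execution
-- of TS ⊗ 𝒜 of nonzero value is an execution of TS paired with the run of 𝒜 on its
-- trace, and inv(φ) reads off F of the automaton component.
module Submission where

open import Defs
open import Data.Nat using (ℕ; zero; suc; _+_)
open import Data.Fin using (Fin; _≟_)
open import Data.Fin.Subset using (⁅_⁆; _∈_)
open import Data.Fin.Subset.Properties using (_∈?_; x∈⁅x⁆; x∈⁅y⁆⇒x≡y)
open import Data.Bool using (true; false; if_then_else_)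
open import Data.List using (List; []; _∷_; _∷ʳ_; foldl; foldr; applyUpTo; allFin; length)
open import Data.List.Properties using (applyUpTo-∷ʳ; foldl-∷ʳ)
open import Data.List.Membership.Propositional using () renaming (_∈_ to _∈ˡ_)
open import Data.List.Membership.Propositional.Properties using (∈-allFin)
open import Data.List.Relation.Unary.Any using (here; there)
open import Data.Product using (_×_; _,_; proj₁; proj₂)
open import Data.Sum using (_⊎_; inj₁; inj₂)
open import Data.Empty using (⊥-elim)
open import Function using (_∘_)
open import Function.Bundles using (_⇔_; mk⇔)
open import Relation.Nullary using (Dec; yes; no; ¬_)
open import Relation.Nullary.Decidable using (⌊_⌋)
open import Relation.Binary.Bundles using (Poset)
open import Relation.Binary.PropositionalEquality
  using (_≡_; _≗_; refl; sym; trans; cong; cong₂; module ≡-Reasoning)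
open import Relation.Binary.Structures using (IsPartialOrder)
import Relation.Binary.Reasoning.PartialOrder as PosetReasoning

applyUpTo-cong : {A : Set} {σ σ′ : ℕ → A} → σ ≗ σ′ → ∀ k → applyUpTo σ k ≡ applyUpTo σ′ k
applyUpTo-cong σ≗σ′ zero    = refl
applyUpTo-cong σ≗σ′ (suc k) = cong₂ _∷_ (σ≗σ′ 0) (applyUpTo-cong (σ≗σ′ ∘ suc) k)

applyUpTo-++ω-length : {A : Set} (θ : List A) (τ : ℕ → A) → applyUpTo (θ ++ω τ) (length θ) ≡ θ
applyUpTo-++ω-length []      τ = refl
applyUpTo-++ω-length (x ∷ θ) τ = cong (x ∷_) (applyUpTo-++ω-length θ τ)

applyUpTo-++ω-drop : {A : Set} (σ : ℕ → A) (k : ℕ) → applyUpTo σ k ++ω (λ j → σ (k + j)) ≗ σ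
applyUpTo-++ω-drop σ zero    i       = refl
applyUpTo-++ω-drop σ (suc k) zero    = refl
applyUpTo-++ω-drop σ (suc k) (suc i) = applyUpTo-++ω-drop (σ ∘ suc) k i

foldl-applyUpTo-suc : {A B : Set} (f : A → B → A) (a : A) (σ : ℕ → B) (k : ℕ) →
                      foldl f a (applyUpTo σ (suc k)) ≡ f (foldl f a (applyUpTo σ k)) (σ k)
foldl-applyUpTo-suc f a σ k = begin
  foldl f a (applyUpTo σ (suc k))    ≡⟨ cong (foldl f a) (applyUpTo-∷ʳ σ k) ⟨
  foldl f a (applyUpTo σ k ∷ʳ σ k)   ≡⟨ foldl-∷ʳ f a (σ k) (applyUpTo σ k) ⟩
  f (foldl f a (applyUpTo σ k)) (σ k) ∎
  where open ≡-Reasoning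

module _ (𝕃 : CDMLattice) where
  open CDMLattice 𝕃
  open IsPartialOrder isPartialOrder using ()
    renaming (refl to ≤-refl; trans to ≤-trans; reflexive to ≤-reflexive)

  poset : Poset _ _ _
  poset = record { isPartialOrder = isPartialOrder }

  open PosetReasoning poset

  x∧y≤x : ∀ {x y} → x ∧ y ≤ x
  x∧y≤x = ⋀-lower _ true

  x∧y≤y : ∀ {x y} → x ∧ y ≤ y
  x∧y≤y = ⋀-lower _ false

  ∧-greatest : ∀ {x y z} → z ≤ x → z ≤ y → z ≤ x ∧ y
  ∧-greatest z≤x z≤y = ⋀-greatest _ _ λ { true → z≤x ; false → z≤y }

  ∧-monotonic : ∀ {x y x′ y′} → x ≤ x′ → y ≤ y′ → x ∧ y ≤ x′ ∧ y′
  ∧-monotonic x≤x′ y≤y′ = ∧-greatest (≤-trans x∧y≤x x≤x′) (≤-trans x∧y≤y y≤y′)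

  ⋀-monotonic : {I : Set} {a b : I → Carrier} → (∀ i → a i ≤ b i) → ⋀ a ≤ ⋀ b
  ⋀-monotonic {a = a} a≤b = ⋀-greatest _ _ λ i → ≤-trans (⋀-lower a i) (a≤b i)

  x≤x∨y : ∀ {x y} → x ≤ x ∨ y
  x≤x∨y = ⋁-upper _ true

  y≤x∨y : ∀ {x y} → y ≤ x ∨ y
  y≤x∨y = ⋁-upper _ false

  ∨-least : ∀ {x y z} → x ≤ z → y ≤ z → x ∨ y ≤ z
  ∨-least x≤z y≤z = ⋁-least _ _ λ { true → x≤z ; false → y≤z }

  0l≤x : ∀ {x} → 0l ≤ x
  0l≤x = ⋁-least _ _ λ ()

  x≤1l : ∀ {x} → x ≤ 1l
  x≤1l = ⋀-greatest _ _ λ ()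

  ~[~x∨~y]≤x : ∀ {x y} → ~ (~ x ∨ ~ y) ≤ x
  ~[~x∨~y]≤x {x} = ≤-trans (~-antitone x≤x∨y) (≤-reflexive (~-involutive x))

  ~[~x∨~y]≤y : ∀ {x y} → ~ (~ x ∨ ~ y) ≤ y
  ~[~x∨~y]≤y {y = y} = ≤-trans (~-antitone y≤x∨y) (≤-reflexive (~-involutive y))

  ~[~x∨~y]-greatest : ∀ {x y z} → z ≤ x → z ≤ y → z ≤ ~ (~ x ∨ ~ y)
  ~[~x∨~y]-greatest {z = z} z≤x z≤y = begin
    z             ≈⟨ ~-involutive z ⟨
    ~ (~ z)       ≤⟨ ~-antitone (∨-least (~-antitone z≤x) (~-antitone z≤y)) ⟩
    ~ (~ _ ∨ ~ _) ∎

  guarded : ∀ {p} {P : Set p} → Dec P → Carrier → Carrier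
  guarded d x = if ⌊ d ⌋ then x else 0l

  guarded≤ : ∀ {p} {P : Set p} (d : Dec P) {x} → guarded d x ≤ x
  guarded≤ (yes _) = ≤-refl
  guarded≤ (no _)  = 0l≤x

  ≤guarded : ∀ {p} {P : Set p} (d : Dec P) {x} → P → x ≤ guarded d x
  ≤guarded (yes _) _ = ≤-refl
  ≤guarded (no ¬p) p = ⊥-elim (¬p p)

  guarded≤0l : ∀ {p} {P : Set p} (d : Dec P) {x} → ¬ P → guarded d x ≤ 0l
  guarded≤0l (yes p) ¬p = ⊥-elim (¬p p)
  guarded≤0l (no _)  _  = ≤-refl

  GPref≤GPref[] : ∀ {n} (P : Word 𝕃 n → Carrier) θ → GPref 𝕃 P θ ≤ GPref 𝕃 P []
  GPref≤GPref[] P θ = ⋁-least _ _ λ τ → ⋁-upper (λ τ → P ([] ++ω τ)) (θ ++ω τ)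

  module _ {m : ℕ} (F : Fin m → Carrier) where

    disjunction : List (Fin m) → Formula 𝕃 m
    disjunction = foldr (λ q ψ → _∧f_ 𝕃 (const (F q)) (atom q) ∨f ψ) (const 0l)

    eval-disjunction-⁅⁆≤ : ∀ q qs → eval 𝕃 (disjunction qs) ⁅ q ⁆ ≤ F q
    eval-disjunction-⁅⁆≤ q []       = 0l≤x
    eval-disjunction-⁅⁆≤ q (q′ ∷ qs) =
      ∨-least (disjunct≤ (q′ ≟ q) (q′ ∈? ⁅ q ⁆)) (eval-disjunction-⁅⁆≤ q qs)
      where
      disjunct≤ : Dec (q′ ≡ q) → (d : Dec (q′ ∈ ⁅ q ⁆)) → ~ (~ F q′ ∨ ~ guarded d 1l) ≤ F q
      disjunct≤ (yes refl) _         = ~[~x∨~y]≤x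
      disjunct≤ (no q′≢q)  (yes q′∈) = ⊥-elim (q′≢q (x∈⁅y⁆⇒x≡y q q′∈))
      disjunct≤ (no _)     (no _)    = ≤-trans ~[~x∨~y]≤y 0l≤x

    ≤eval-disjunction-⁅⁆ : ∀ q qs → q ∈ˡ qs → F q ≤ eval 𝕃 (disjunction qs) ⁅ q ⁆
    ≤eval-disjunction-⁅⁆ q (q ∷ qs) (here refl) =
      ≤-trans (~[~x∨~y]-greatest ≤-refl (≤-trans x≤1l (≤guarded (q ∈? ⁅ q ⁆) (x∈⁅x⁆ q)))) x≤x∨y
    ≤eval-disjunction-⁅⁆ q (_ ∷ qs) (there q∈qs) =
      ≤-trans (≤eval-disjunction-⁅⁆ q qs q∈qs) y≤x∨y

  module Conditions {S Act : Set} {n nQ : ℕ} (TS : MvTS 𝕃 S Act n) (𝒜 : VDFA 𝕃 nQ n) where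
    open MvTS TS
    open VDFA 𝒜
    open Exec

    trace : Exec 𝕃 S Act → Word 𝕃 n
    trace ρ i = L (st ρ i)

    run : Word 𝕃 n → ℕ → Fin nQ
    run σ zero    = δ q₀ (σ 0)
    run σ (suc i) = δ (run σ i) (σ (suc i))

    run≡foldl : ∀ σ i → run σ i ≡ foldl δ q₀ (applyUpTo σ (suc i))
    run≡foldl σ zero    = refl
    run≡foldl σ (suc i) =
      trans (cong (λ q → δ q (σ (suc i))) (run≡foldl σ i)) (sym (foldl-applyUpTo-suc δ q₀ σ (suc i)))

    TS⊗𝒜 : MvTS 𝕃 (S × Fin nQ) Act nQ
    TS⊗𝒜 = _⊗_ 𝕃 TS 𝒜

    lift : Exec 𝕃 S Act → Exec 𝕃 (S × Fin nQ) Act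
    lift ρ = record { st = λ i → st ρ i , run (trace ρ) i ; act = act ρ }

    project : Exec 𝕃 (S × Fin nQ) Act → Exec 𝕃 S Act
    project ρ = record { st = proj₁ ∘ st ρ ; act = act ρ }

    value≤value-lift : ∀ ρ → value 𝕃 TS ρ ≤ value 𝕃 TS⊗𝒜 (lift ρ)
    value≤value-lift ρ = ∧-monotonic (≤guarded (δ q₀ (σ 0) ≟ run σ 0) refl)
      (⋀-monotonic λ i → ≤guarded (δ (run σ i) (σ (suc i)) ≟ run σ (suc i)) refl)
      where
      σ : Word 𝕃 n
      σ = trace ρ

    value≤value-project : ∀ ρ → value 𝕃 TS⊗𝒜 ρ ≤ value 𝕃 TS (project ρ)
    value≤value-project ρ = ∧-monotonic (guarded≤ (δ q₀ (L (s 0)) ≟ q 0))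
      (⋀-monotonic λ i → guarded≤ (δ (q i) (L (s (suc i))) ≟ q (suc i)))
      where
      s : ℕ → S
      s = proj₁ ∘ st ρ
      q : ℕ → Fin nQ
      q = proj₂ ∘ st ρ

    null⊎synchronised : ∀ ρ i → value 𝕃 TS⊗𝒜 ρ ≤ 0l ⊎ proj₂ (st ρ i) ≡ run (trace (project ρ)) i
    null⊎synchronised ρ zero with δ q₀ (L (proj₁ (st ρ 0))) ≟ proj₂ (st ρ 0)
    ... | yes initial = inj₂ (sym initial)
    ... | no _        = inj₁ x∧y≤x
    null⊎synchronised ρ (suc i) = step (null⊎synchronised ρ i) (δ (q i) (L (s (suc i))) ≟ q (suc i))
      where
      s : ℕ → S
      s = proj₁ ∘ st ρ
      q : ℕ → Fin nQ
      q = proj₂ ∘ st ρ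
      step : value 𝕃 TS⊗𝒜 ρ ≤ 0l ⊎ q i ≡ run (trace (project ρ)) i →
             Dec (δ (q i) (L (s (suc i))) ≡ q (suc i)) →
             value 𝕃 TS⊗𝒜 ρ ≤ 0l ⊎ q (suc i) ≡ run (trace (project ρ)) (suc i)
      step (inj₁ null) _           = inj₁ null
      step (inj₂ sync) (yes moves) = inj₂ (trans (sym moves) (cong (λ p → δ p (L (s (suc i)))) sync))
      step (inj₂ _)    (no ¬moves) =
        inj₁ (≤-trans x∧y≤y (≤-trans (⋀-lower _ i) (guarded≤0l (δ (q i) (L (s (suc i))) ≟ q (suc i)) ¬moves)))

    value≤Traces-fin-applyUpTo : ∀ ρ k → value 𝕃 TS ρ ≤ Traces-fin 𝕃 TS (applyUpTo (trace ρ) k)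
    value≤Traces-fin-applyUpTo ρ k = begin
      value 𝕃 TS ρ                                  ≤⟨ ⋁-upper _ (ρ , sym ∘ applyUpTo-++ω-drop (trace ρ) k) ⟩
      Traces 𝕃 TS (applyUpTo (trace ρ) k ++ω drop) ≤⟨ ⋁-upper _ drop ⟩
      Traces-fin 𝕃 TS (applyUpTo (trace ρ) k)       ∎
      where
      drop : Word 𝕃 n
      drop j = trace ρ (k + j)

    Traces-fin⊆Lang : Set
    Traces-fin⊆Lang = ∀ θ → Traces-fin 𝕃 TS θ ≤ Lang 𝕃 𝒜 θ

    PrefixBounded : Set
    PrefixBounded = ∀ ρ k → value 𝕃 TS ρ ≤ Lang 𝕃 𝒜 (applyUpTo (trace ρ) k)

    RunBounded : Set
    RunBounded = ∀ ρ i → value 𝕃 TS ρ ≤ F (run (trace ρ) i)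

    Traces-fin⊆Lang⇒PrefixBounded : Traces-fin⊆Lang → PrefixBounded
    Traces-fin⊆Lang⇒PrefixBounded ⊆Lang ρ k = ≤-trans (value≤Traces-fin-applyUpTo ρ k) (⊆Lang (applyUpTo (trace ρ) k))

    PrefixBounded⇒Traces-fin⊆Lang : PrefixBounded → Traces-fin⊆Lang
    PrefixBounded⇒Traces-fin⊆Lang bounded θ = ⋁-least _ _ λ τ → ⋁-least _ _ λ { (ρ , trace≗) → begin
      value 𝕃 TS ρ                                  ≤⟨ bounded ρ (length θ) ⟩
      Lang 𝕃 𝒜 (applyUpTo (trace ρ) (length θ))   ≡⟨ cong (Lang 𝕃 𝒜) (applyUpTo-cong trace≗ (length θ)) ⟩
      Lang 𝕃 𝒜 (applyUpTo (θ ++ω τ) (length θ))   ≡⟨ cong (Lang 𝕃 𝒜) (applyUpTo-++ω-length θ τ) ⟩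
      Lang 𝕃 𝒜 θ                                    ∎ }

    RunBounded⇒⊨inv-φ : RunBounded → _⊨_ 𝕃 TS⊗𝒜 (inv 𝕃 (φ 𝕃 𝒜))
    RunBounded⇒⊨inv-φ bounded w = ⋁-least _ _ λ { (ρ , trace≗w) → ⋀-greatest _ _ λ i → begin
      value 𝕃 TS⊗𝒜 ρ                     ≤⟨ value≤F ρ i ⟩
      F (proj₂ (st ρ i))                  ≤⟨ ≤eval-disjunction-⁅⁆ F _ (allFin nQ) (∈-allFin _) ⟩
      eval 𝕃 (φ 𝕃 𝒜) ⁅ proj₂ (st ρ i) ⁆ ≡⟨ cong (eval 𝕃 (φ 𝕃 𝒜)) (trace≗w i) ⟩
      eval 𝕃 (φ 𝕃 𝒜) (w i)               ∎ }
      where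
      value≤F : ∀ ρ i → value 𝕃 TS⊗𝒜 ρ ≤ F (proj₂ (st ρ i))
      value≤F ρ i with null⊎synchronised ρ i
      ... | inj₁ null = ≤-trans null 0l≤x
      ... | inj₂ sync = begin
        value 𝕃 TS⊗𝒜 ρ                  ≤⟨ value≤value-project ρ ⟩
        value 𝕃 TS (project ρ)           ≤⟨ bounded (project ρ) i ⟩
        F (run (trace (project ρ)) i)    ≡⟨ cong F sync ⟨
        F (proj₂ (st ρ i))               ∎

    ⊨inv-φ⇒RunBounded : _⊨_ 𝕃 TS⊗𝒜 (inv 𝕃 (φ 𝕃 𝒜)) → RunBounded
    ⊨inv-φ⇒RunBounded ⊨inv ρ i = begin
      value 𝕃 TS ρ                        ≤⟨ value≤value-lift ρ ⟩
      value 𝕃 TS⊗𝒜 (lift ρ)              ≤⟨ ⋁-upper _ (lift ρ , λ _ → refl) ⟩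
      Traces 𝕃 TS⊗𝒜 runs                 ≤⟨ ⊨inv runs ⟩
      inv 𝕃 (φ 𝕃 𝒜) runs                 ≤⟨ ⋀-lower _ i ⟩
      eval 𝕃 (φ 𝕃 𝒜) ⁅ run (trace ρ) i ⁆ ≤⟨ eval-disjunction-⁅⁆≤ F _ (allFin nQ) ⟩
      F (run (trace ρ) i)                 ∎
      where
      runs : Word 𝕃 nQ
      runs j = ⁅ run (trace ρ) j ⁆

    module _ (P : Word 𝕃 n → Carrier) (Lang≈GPref : ∀ θ → Lang 𝕃 𝒜 θ ≈ GPref 𝕃 P θ) where

      ⊨⇒Traces-fin⊆Lang : _⊨_ 𝕃 TS P → Traces-fin⊆Lang
      ⊨⇒Traces-fin⊆Lang ⊨P θ = ⋁-least _ _ λ τ → begin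
        Traces 𝕃 TS (θ ++ω τ) ≤⟨ ⊨P (θ ++ω τ) ⟩
        P (θ ++ω τ)           ≤⟨ ⋁-upper _ τ ⟩
        GPref 𝕃 P θ           ≈⟨ Lang≈GPref θ ⟨
        Lang 𝕃 𝒜 θ            ∎

      PrefixBounded⇒⊨ : IsSafety 𝕃 P → PrefixBounded → _⊨_ 𝕃 TS P
      PrefixBounded⇒⊨ safe bounded σ = ⋁-least _ _ λ { (ρ , trace≗σ) →
        ≤-trans (⋀-greatest _ _ λ k → begin
          value 𝕃 TS ρ                          ≤⟨ bounded ρ k ⟩
          Lang 𝕃 𝒜 (applyUpTo (trace ρ) k)    ≡⟨ cong (Lang 𝕃 𝒜) (applyUpTo-cong trace≗σ k) ⟩
          Lang 𝕃 𝒜 (applyUpTo σ k)            ≈⟨ Lang≈GPref (applyUpTo σ k) ⟩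
          GPref 𝕃 P (applyUpTo σ k)            ∎)
        (safe σ) }

      RunBounded⇒PrefixBounded : RunBounded → PrefixBounded
      RunBounded⇒PrefixBounded bounded ρ zero = begin
        value 𝕃 TS ρ              ≤⟨ bounded ρ 0 ⟩
        Lang 𝕃 𝒜 (trace ρ 0 ∷ []) ≈⟨ Lang≈GPref (trace ρ 0 ∷ []) ⟩
        GPref 𝕃 P (trace ρ 0 ∷ []) ≤⟨ GPref≤GPref[] P (trace ρ 0 ∷ []) ⟩
        GPref 𝕃 P []              ≈⟨ Lang≈GPref [] ⟨
        Lang 𝕃 𝒜 []               ∎
      RunBounded⇒PrefixBounded bounded ρ (suc i) = begin
        value 𝕃 TS ρ                              ≤⟨ bounded ρ i ⟩
        F (run (trace ρ) i)                        ≡⟨ cong F (run≡foldl (trace ρ) i) ⟩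
        Lang 𝕃 𝒜 (applyUpTo (trace ρ) (suc i))   ∎

      PrefixBounded⇒RunBounded : PrefixBounded → RunBounded
      PrefixBounded⇒RunBounded bounded ρ i = begin
        value 𝕃 TS ρ                              ≤⟨ bounded ρ (suc i) ⟩
        Lang 𝕃 𝒜 (applyUpTo (trace ρ) (suc i))   ≡⟨ cong F (run≡foldl (trace ρ) i) ⟨
        F (run (trace ρ) i)                        ∎

-- Executions are infinite by definition.
theorem2 : (𝕃 : CDMLattice) {nS nAct nAP nQ : ℕ}
    (TS : MvTS 𝕃 (Fin nS) (Fin nAct) nAP) → NoTerminal 𝕃 TS →
    (P : Word 𝕃 nAP → CDMLattice.Carrier 𝕃) → Extensional 𝕃 P → IsSafety 𝕃 P →
    (𝒜 : VDFA 𝕃 nQ nAP) →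
    ((θ : FinWord 𝕃 nAP) → CDMLattice._≈_ 𝕃 (Lang 𝕃 𝒜 θ) (GPref 𝕃 P θ)) →
    ((_⊨_ 𝕃 TS P)
    ⇔ ((θ : FinWord 𝕃 nAP) → CDMLattice._≤_ 𝕃 (Traces-fin 𝕃 TS θ) (Lang 𝕃 𝒜 θ)))
    × (((θ : FinWord 𝕃 nAP) → CDMLattice._≤_ 𝕃 (Traces-fin 𝕃 TS θ) (Lang 𝕃 𝒜 θ))
    ⇔ (_⊨_ 𝕃 (_⊗_ 𝕃 TS 𝒜) (inv 𝕃 (φ 𝕃 𝒜))))
theorem2 𝕃 TS _ P _ safe 𝒜 Lang≈GPref =
    mk⇔ (⊨⇒Traces-fin⊆Lang P Lang≈GPref)
        (PrefixBounded⇒⊨ P Lang≈GPref safe ∘ Traces-fin⊆Lang⇒PrefixBounded)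
  , mk⇔ (RunBounded⇒⊨inv-φ ∘ PrefixBounded⇒RunBounded P Lang≈GPref ∘ Traces-fin⊆Lang⇒PrefixBounded)
        (PrefixBounded⇒Traces-fin⊆Lang ∘ RunBounded⇒PrefixBounded P Lang≈GPref ∘ ⊨inv-φ⇒RunBounded)
  where open Conditions 𝕃 TS 𝒜
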